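{- Let $a,b,p,q$ be complex numbers with $p\neq 0$, $q\neq 0$, and let $(W_j)$, $(U_j)$ be as defined in the context. If $n$ is a non-negative integer, $m$ is any real number and $r$, $s$ and $t$ are any integers, then \[ \sum_{k = 0}^n \binom nk\binom{m + k}{k}q^{rk} U_r^{n - k} U_s^kW_{t - (r + s)k + sn} = \sum_{k = 0}^n \binom nk\binom mk q^{rk} U_{r + s}^{n - k} U_s^kW_{t - rk}. \]
   Context: The Horadam sequence $W_j=W_j(a,b;p,q)$ is defined by $W_0=a$, $W_1=b$, $W_j=pW_{j-1}-qW_{j-2}$ for $j\ge 2$, and extended to negative indices by $W_{ -j}=\frac{1}{q}(pW_{ -j+1}-W_{ -j+2})$. The Lucas sequence of the first kind is $U_j=W_j(0,1;p,q)$. For a real number $x$ and a non-negative integer $k$, $\binom{x}{k}=x(x-1)\cdots(x-k+1)/k!$. -}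

module Defs where

open import Level using (_⊔_)
open import Algebra.Bundles using (CommutativeRing)
open import Data.Nat as ℕ using (ℕ; zero; suc)
open import Data.Nat.Combinatorics using (_C_)
open import Data.Nat.Base using (_!)
open import Data.Integer as ℤ using (ℤ; +_; -[1+_])
open import Data.Product using (_×_; _,_; proj₁; proj₂)
open import Relation.Nullary using (¬_)

natCast : ∀ {c ℓ} (R : CommutativeRing c ℓ) → ℕ → CommutativeRing.Carrier R
natCast R zero    = CommutativeRing.0# R
natCast R (suc n) = CommutativeRing._+_ R (CommutativeRing.1# R) (natCast R n)

-- A field of characteristic zero (the complex numbers are one).
-- agda-stdlib has no Field bundle, so we define it: a commutative ring
-- with a multiplicative inverse for every non-zero element, in which
-- 1 + 1 + ... + 1 (n+1 times) is never 0.
record CharZeroField c ℓ : Set (Level.suc (c ⊔ ℓ)) where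
  field
    commutativeRing : CommutativeRing c ℓ
  open CommutativeRing commutativeRing public
    using (Carrier; _≈_; _+_; _*_; -_; _-_; 0#; 1#)
  field
    _⁻¹     : Carrier → Carrier
    ⁻¹-inverse : ∀ x → ¬ (x ≈ 0#) → x * (x ⁻¹) ≈ 1#

    charZero : ∀ n → ¬ (natCast commutativeRing (suc n) ≈ 0#)

  ι : ℕ → Carrier
  ι = natCast commutativeRing

  pow : Carrier → ℕ → Carrier
  pow x zero    = 1#
  pow x (suc n) = x * pow x n

  -- integer powers (x^(-n) = (x⁻¹)^n), meaningful for x ≠ 0
  zpow : Carrier → ℤ → Carrier
  zpow x (+ n)      = pow x n
  zpow x -[1+ n ]   = pow (x ⁻¹) (suc n)

  sumTo : ℕ → (ℕ → Carrier) → Carrier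
  sumTo zero    f = f zero
  sumTo (suc n) f = sumTo n f + f (suc n)

  falling : Carrier → ℕ → Carrier
  falling x zero    = 1#
  falling x (suc k) = falling x k * (x - ι k)

  binom : Carrier → ℕ → Carrier
  binom x k = falling x k * (ι (k !) ⁻¹)

  module Horadam (a b p q : Carrier) where
    -- Wpos n = (W_n , W_{n+1})
    Wpos : ℕ → Carrier × Carrier
    Wpos zero    = a , b
    Wpos (suc n) = proj₂ (Wpos n) , (p * proj₂ (Wpos n) - q * proj₁ (Wpos n))

    -- Wneg j = (W_{-j} , W_{-j+1}), using W_{-j} = (p W_{-j+1} - W_{-j+2}) / q
    Wneg : ℕ → Carrier × Carrier
    Wneg zero    = a , b
    Wneg (suc j) = (q ⁻¹) * (p * proj₁ (Wneg j) - proj₂ (Wneg j)) , proj₁ (Wneg j)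

    W : ℤ → Carrier
    W (+ n)      = proj₁ (Wpos n)
    W -[1+ n ]   = proj₁ (Wneg (suc n))

  W : Carrier → Carrier → Carrier → Carrier → ℤ → Carrier
  W a b p q = Horadam.W a b p q

  U : Carrier → Carrier → ℤ → Carrier
  U p q = W 0# 1# p q

-- Put u = U_r, v = q^r U_s, w = U_{r+s} and g(i,j) = W_{t+si-rj}. The addition formula
--   U_r W_{t+s} + q^r U_s W_{t-r} = U_{r+s} W_t
-- holds because, as functions of r (for s = 1) and then of s, both sides solve the recurrence
-- x_{j+2} = p x_{j+1} - q x_j, which has a unique solution with given x_0 and x_1 when q ≠ 0.
-- It says exactly that u g(i+1,j) + v g(i,j+1) = w g(i,j). Both sides of the theorem are binomial
-- sums  Σ_k C(n,k) x^(n-k) v^k f(n-k,k),  with x = u, f(i,j) = binom(m+j,j) g(i,j) on the left and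
-- x = w, f(i,j) = binom(m,j) g(0,j) on the right. Replacing binom(m+i,j) by any array obeying
-- Pascal's rule, induction on n shows that the two sums satisfy the same recursion in n.
module Submission where

open import Defs
open import Algebra.Bundles using (CommutativeRing)
open import Data.Nat as ℕ using (ℕ; zero; suc; _∸_; _≤_; _!)
import Data.Nat.Properties as ℕ
open import Data.Nat.Combinatorics using (_C_; k>n⇒nCk≡0; nCk+nC[k+1]≡[n+1]C[k+1])
open import Data.Integer as ℤ using (ℤ; +_; -[1+_])
import Data.Integer.Properties as ℤ
open import Data.Integer.Tactic.RingSolver using (solve-∀)
open import Data.Product using (_×_; _,_; proj₁)
open import Relation.Nullary using (¬_)
open import Relation.Binary.PropositionalEquality as ≡ using (_≡_)

ℤ-induction : ∀ {p} (P : ℤ → Set p) → P (+ 0) →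
              (∀ i → P i → P (ℤ.suc i)) → (∀ i → P (ℤ.suc i) → P i) → ∀ i → P i
ℤ-induction P P0 up down (+ zero)      = P0
ℤ-induction P P0 up down (+ suc n)     = up (+ n) (ℤ-induction P P0 up down (+ n))
ℤ-induction P P0 up down -[1+ zero ]   = down -[1+ 0 ] P0
ℤ-induction P P0 up down -[1+ suc n ]  = down -[1+ suc n ] (ℤ-induction P P0 up down -[1+ n ])

-- Stated with `+ 1 ℤ.+ j`, which is `ℤ.suc j` by definition, since solve-∀ does not unfold ℤ.suc.
+-suc : ∀ i j → i ℤ.+ (+ 1 ℤ.+ j) ≡ + 1 ℤ.+ (i ℤ.+ j)
+-suc = solve-∀

suc[i-suc[j]] : ∀ i j → + 1 ℤ.+ (i ℤ.- (+ 1 ℤ.+ j)) ≡ i ℤ.- j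
suc[i-suc[j]] = solve-∀

*-suc : ∀ i j → i ℤ.* (+ 1 ℤ.+ j) ≡ i ℤ.+ i ℤ.* j
*-suc = solve-∀

[t-[r+s]j]+s[i+j]≡t+si-rj : ∀ t r s i j →
  (t ℤ.- (r ℤ.+ s) ℤ.* j) ℤ.+ s ℤ.* (i ℤ.+ j) ≡ t ℤ.+ s ℤ.* i ℤ.- r ℤ.* j
[t-[r+s]j]+s[i+j]≡t+si-rj = solve-∀

t-rj≡t+s0-rj : ∀ t r s j → t ℤ.- r ℤ.* j ≡ t ℤ.+ s ℤ.* + 0 ℤ.- r ℤ.* j
t-rj≡t+s0-rj = solve-∀

t+s[1+i]-rj≡[t+si-rj]+s : ∀ t r s i j →
  t ℤ.+ s ℤ.* (+ 1 ℤ.+ i) ℤ.- r ℤ.* j ≡ (t ℤ.+ s ℤ.* i ℤ.- r ℤ.* j) ℤ.+ s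
t+s[1+i]-rj≡[t+si-rj]+s = solve-∀

t+si-r[1+j]≡[t+si-rj]-r : ∀ t r s i j →
  t ℤ.+ s ℤ.* i ℤ.- r ℤ.* (+ 1 ℤ.+ j) ≡ (t ℤ.+ s ℤ.* i ℤ.- r ℤ.* j) ℤ.- r
t+si-r[1+j]≡[t+si-rj]-r = solve-∀

module Lemmas {c ℓ} (F : CharZeroField c ℓ) where
  open CharZeroField F
  open CommutativeRing commutativeRing
    using (setoid; commutativeSemiring; +-abelianGroup
          ; refl; sym; trans; reflexive; +-cong; +-congˡ; +-congʳ; *-cong; *-congˡ; *-congʳ
          ; +-assoc; +-comm; +-identityˡ; +-identityʳ; -‿cong
          ; *-assoc; *-comm; *-identityˡ; *-identityʳ; zeroˡ; zeroʳ; distribˡ; distribʳ)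
  open import Relation.Binary.Reasoning.Setoid setoid
  open import Algebra.Solver.Ring.NaturalCoefficients.Default commutativeSemiring
  open import Algebra.Properties.AbelianGroup +-abelianGroup
    using (//-rightDividesˡ) renaming (∙-cancelˡ to +-cancelˡ; ∙-cancelʳ to +-cancelʳ; ε⁻¹≈ε to -0#≈0#)

  ≡⇒≈ : ∀ {A : Set} (f : A → Carrier) {i j} → i ≡ j → f i ≈ f j
  ≡⇒≈ f i≡j = reflexive (≡.cong f i≡j)

  x-y+y≈x : ∀ x y → x - y + y ≈ x
  x-y+y≈x x y = //-rightDividesˡ y x

  x*[x⁻¹*y]≈y : ∀ {x} → ¬ x ≈ 0# → ∀ y → x * (x ⁻¹ * y) ≈ y
  x*[x⁻¹*y]≈y {x} x≉0 y = begin
    x * (x ⁻¹ * y)  ≈⟨ *-assoc x (x ⁻¹) y ⟨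
    x * x ⁻¹ * y    ≈⟨ *-congʳ (⁻¹-inverse x x≉0) ⟩
    1# * y          ≈⟨ *-identityˡ y ⟩
    y               ∎

  x⁻¹*[x*y]≈y : ∀ {x} → ¬ x ≈ 0# → ∀ y → x ⁻¹ * (x * y) ≈ y
  x⁻¹*[x*y]≈y {x} x≉0 y = begin
    x ⁻¹ * (x * y)  ≈⟨ solve 3 (λ x x⁻¹ y → x⁻¹ :* (x :* y) := x :* (x⁻¹ :* y)) refl x (x ⁻¹) y ⟩
    x * (x ⁻¹ * y)  ≈⟨ x*[x⁻¹*y]≈y x≉0 y ⟩
    y               ∎

  *-cancelˡ : ∀ {x y z} → ¬ x ≈ 0# → x * y ≈ x * z → y ≈ z
  *-cancelˡ {x} {y} {z} x≉0 xy≈xz = begin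
    y               ≈⟨ x⁻¹*[x*y]≈y x≉0 y ⟨
    x ⁻¹ * (x * y)  ≈⟨ *-congˡ xy≈xz ⟩
    x ⁻¹ * (x * z)  ≈⟨ x⁻¹*[x*y]≈y x≉0 z ⟩
    z               ∎

  ⁻¹-unique : ∀ {x y} → ¬ x ≈ 0# → x * y ≈ 1# → y ≈ x ⁻¹
  ⁻¹-unique {x} {y} x≉0 xy≈1 = *-cancelˡ x≉0 (trans xy≈1 (sym (⁻¹-inverse x x≉0)))

  ι-+ : ∀ m n → ι (m ℕ.+ n) ≈ ι m + ι n
  ι-+ zero    n = sym (+-identityˡ (ι n))
  ι-+ (suc m) n = trans (+-congˡ (ι-+ m n)) (sym (+-assoc 1# (ι m) (ι n)))

  ι-* : ∀ m n → ι (m ℕ.* n) ≈ ι m * ι n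
  ι-* zero    n = sym (zeroˡ (ι n))
  ι-* (suc m) n = begin
    ι (n ℕ.+ m ℕ.* n)    ≈⟨ ι-+ n (m ℕ.* n) ⟩
    ι n + ι (m ℕ.* n)    ≈⟨ +-congˡ (ι-* m n) ⟩
    ι n + ι m * ι n      ≈⟨ solve 2 (λ x y → x :+ y :* x := (con 1 :+ y) :* x) refl (ι n) (ι m) ⟩
    (1# + ι m) * ι n     ∎

  ι-!≉0 : ∀ k → ¬ ι (k !) ≈ 0#
  ι-!≉0 k = ≡.subst (λ n → ¬ ι n ≈ 0#) (ℕ.suc-pred (k !) {{k ℕ.!≢0}}) (charZero (ℕ.pred (k !)))

  ι[1+k]*[1+k]!⁻¹≈k!⁻¹ : ∀ k → ι (suc k) * ι (suc k !) ⁻¹ ≈ ι (k !) ⁻¹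
  ι[1+k]*[1+k]!⁻¹≈k!⁻¹ k = ⁻¹-unique (ι-!≉0 k) (begin
    ι (k !) * (ι (suc k) * ι (suc k !) ⁻¹)  ≈⟨ *-assoc _ _ _ ⟨
    ι (k !) * ι (suc k) * ι (suc k !) ⁻¹    ≈⟨ *-congʳ (trans (*-comm _ _) (sym (ι-* (suc k) (k !)))) ⟩
    ι (suc k !) * ι (suc k !) ⁻¹            ≈⟨ ⁻¹-inverse _ (ι-!≉0 (suc k)) ⟩
    1#                                       ∎)

  pow-* : ∀ x y k → pow (x * y) k ≈ pow x k * pow y k
  pow-* x y zero    = sym (*-identityˡ 1#)
  pow-* x y (suc k) = begin
    x * y * pow (x * y) k
      ≈⟨ *-congˡ (pow-* x y k) ⟩
    x * y * (pow x k * pow y k)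
      ≈⟨ solve 4 (λ x y a b → x :* y :* (a :* b) := x :* a :* (y :* b)) refl x y (pow x k) (pow y k) ⟩
    x * pow x k * (y * pow y k)
      ∎

  module _ {q : Carrier} (q≉0 : ¬ q ≈ 0#) where

    zpow-suc : ∀ j → zpow q (ℤ.suc j) ≈ q * zpow q j
    zpow-suc (+ n)          = refl
    zpow-suc -[1+ zero ]    = sym (x*[x⁻¹*y]≈y q≉0 _)
    zpow-suc -[1+ suc n ]   = sym (x*[x⁻¹*y]≈y q≉0 _)

    zpow-+ : ∀ i j → zpow q (i ℤ.+ j) ≈ zpow q i * zpow q j
    zpow-+ i = ℤ-induction (λ j → zpow q (i ℤ.+ j) ≈ zpow q i * zpow q j) base
                 (λ j e → trans (lhs-suc j) (trans (*-congˡ e) (sym (rhs-suc j))))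
                 (λ j e → *-cancelˡ q≉0 (trans (sym (lhs-suc j)) (trans e (rhs-suc j))))
      where
      base : zpow q (i ℤ.+ + 0) ≈ zpow q i * 1#
      base = trans (≡⇒≈ (zpow q) (ℤ.+-identityʳ i)) (sym (*-identityʳ _))
      lhs-suc : ∀ j → zpow q (i ℤ.+ ℤ.suc j) ≈ q * zpow q (i ℤ.+ j)
      lhs-suc j = trans (≡⇒≈ (zpow q) (+-suc i j)) (zpow-suc (i ℤ.+ j))
      rhs-suc : ∀ j → zpow q i * zpow q (ℤ.suc j) ≈ q * (zpow q i * zpow q j)
      rhs-suc j = trans (*-congˡ (zpow-suc j)) (solve 3 (λ a q b → a :* (q :* b) := q :* (a :* b)) refl _ q _)

    zpow-*-pow : ∀ r k → zpow q (r ℤ.* + k) ≈ pow (zpow q r) k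
    zpow-*-pow r zero    = ≡⇒≈ (zpow q) (ℤ.*-zeroʳ r)
    zpow-*-pow r (suc k) = begin
      zpow q (r ℤ.* + suc k)              ≈⟨ ≡⇒≈ (zpow q) (*-suc r (+ k)) ⟩
      zpow q (r ℤ.+ r ℤ.* + k)            ≈⟨ zpow-+ r (r ℤ.* + k) ⟩
      zpow q r * zpow q (r ℤ.* + k)       ≈⟨ *-congˡ (zpow-*-pow r k) ⟩
      zpow q r * pow (zpow q r) k         ∎

  x+1-[1+y]≈x-y : ∀ x y → (x + 1#) - (1# + y) ≈ x - y
  x+1-[1+y]≈x-y x y = +-cancelʳ (1# + y) _ _ (begin
    (x + 1#) - (1# + y) + (1# + y)  ≈⟨ x-y+y≈x (x + 1#) (1# + y) ⟩
    x + 1#                          ≈⟨ +-congʳ (x-y+y≈x x y) ⟨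
    x - y + y + 1#                  ≈⟨ solve 2 (λ d y → d :+ y :+ con 1 := d :+ (con 1 :+ y)) refl (x - y) y ⟩
    x - y + (1# + y)                ∎)

  falling-cong : ∀ {x y} k → x ≈ y → falling x k ≈ falling y k
  falling-cong zero    x≈y = refl
  falling-cong (suc k) x≈y = *-cong (falling-cong k x≈y) (+-congʳ x≈y)

  binom-cong : ∀ {x y} k → x ≈ y → binom x k ≈ binom y k
  binom-cong k x≈y = *-congʳ (falling-cong k x≈y)

  falling-+1 : ∀ x k → falling (x + 1#) (suc k) ≈ (x + 1#) * falling x k
  falling-+1 x zero = begin
    1# * (x + 1# - 0#)  ≈⟨ *-identityˡ _ ⟩
    x + 1# + - 0#       ≈⟨ +-congˡ -0#≈0# ⟩
    x + 1# + 0#         ≈⟨ +-identityʳ _ ⟩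
    x + 1#              ≈⟨ *-identityʳ _ ⟨
    (x + 1#) * 1#       ∎
  falling-+1 x (suc k) = begin
    falling (x + 1#) (suc k) * (x + 1# - ι (suc k))  ≈⟨ *-cong (falling-+1 x k) (x+1-[1+y]≈x-y x (ι k)) ⟩
    (x + 1#) * falling x k * (x - ι k)              ≈⟨ *-assoc _ _ _ ⟩
    (x + 1#) * falling x (suc k)                    ∎

  falling-pascal : ∀ x k → falling (x + 1#) (suc k) ≈ falling x (suc k) + ι (suc k) * falling x k
  falling-pascal x k = begin
    falling (x + 1#) (suc k)
      ≈⟨ falling-+1 x k ⟩
    (x + 1#) * falling x k
      ≈⟨ *-congʳ (+-congʳ (x-y+y≈x x (ι k))) ⟨
    (x - ι k + ι k + 1#) * falling x k
      ≈⟨ solve 3 (λ f d i → (d :+ i :+ con 1) :* f := f :* d :+ (con 1 :+ i) :* f) refl (falling x k) (x - ι k) (ι k) ⟩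
    falling x k * (x - ι k) + ι (suc k) * falling x k
      ∎

  binom-pascal : ∀ x k → binom (x + 1#) (suc k) ≈ binom x (suc k) + binom x k
  binom-pascal x k = begin
    falling (x + 1#) (suc k) * [1+k]!⁻¹
      ≈⟨ *-congʳ (falling-pascal x k) ⟩
    (falling x (suc k) + ι (suc k) * falling x k) * [1+k]!⁻¹
      ≈⟨ distribʳ _ _ _ ⟩
    binom x (suc k) + ι (suc k) * falling x k * [1+k]!⁻¹
      ≈⟨ +-congˡ (solve 3 (λ i f j → i :* f :* j := f :* (i :* j)) refl (ι (suc k)) (falling x k) [1+k]!⁻¹) ⟩
    binom x (suc k) + falling x k * (ι (suc k) * [1+k]!⁻¹)
      ≈⟨ +-congˡ (*-congˡ (ι[1+k]*[1+k]!⁻¹≈k!⁻¹ k)) ⟩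
    binom x (suc k) + binom x k
      ∎
    where [1+k]!⁻¹ = ι (suc k !) ⁻¹

  sumTo-cong : ∀ n {f g} → (∀ k → k ≤ n → f k ≈ g k) → sumTo n f ≈ sumTo n g
  sumTo-cong zero    f≈g = f≈g 0 ℕ.z≤n
  sumTo-cong (suc n) f≈g =
    +-cong (sumTo-cong n (λ k k≤n → f≈g k (ℕ.m≤n⇒m≤1+n k≤n))) (f≈g (suc n) ℕ.≤-refl)

  sumTo-+ : ∀ n f g → sumTo n (λ k → f k + g k) ≈ sumTo n f + sumTo n g
  sumTo-+ zero    f g = refl
  sumTo-+ (suc n) f g = begin
    sumTo n (λ k → f k + g k) + (f (suc n) + g (suc n))
      ≈⟨ +-congʳ (sumTo-+ n f g) ⟩
    sumTo n f + sumTo n g + (f (suc n) + g (suc n))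
      ≈⟨ solve 4 (λ a b c d → a :+ b :+ (c :+ d) := a :+ c :+ (b :+ d)) refl _ _ _ _ ⟩
    sumTo n f + f (suc n) + (sumTo n g + g (suc n))
      ∎

  sumTo-*ˡ : ∀ n x f → x * sumTo n f ≈ sumTo n (λ k → x * f k)
  sumTo-*ˡ zero    x f = refl
  sumTo-*ˡ (suc n) x f = trans (distribˡ x _ _) (+-congʳ (sumTo-*ˡ n x f))

  sumTo-suc : ∀ n f → sumTo (suc n) f ≈ f 0 + sumTo n (λ k → f (suc k))
  sumTo-suc zero    f = refl
  sumTo-suc (suc n) f = trans (+-congʳ (sumTo-suc n f)) (+-assoc _ _ _)

  sumTo-pascal : ∀ n (f : ℕ → Carrier) →
    sumTo (suc n) (λ k → ι (suc n C k) * f k)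
      ≈ sumTo n (λ k → ι (n C k) * f k) + sumTo n (λ k → ι (n C k) * f (suc k))
  sumTo-pascal n f = begin
    sumTo (suc n) (λ k → ι (suc n C k) * f k)
      ≈⟨ sumTo-suc n _ ⟩
    ι (suc n C 0) * f 0 + sumTo n (λ k → ι (suc n C suc k) * f (suc k))
      ≈⟨ +-congˡ (sumTo-cong n (λ k _ → pascal k)) ⟩
    ι (suc n C 0) * f 0 + sumTo n (λ k → ι (n C suc k) * f (suc k) + ι (n C k) * f (suc k))
      ≈⟨ +-congˡ (sumTo-+ n _ _) ⟩
    ι (suc n C 0) * f 0 + (sumTo n (λ k → ι (n C suc k) * f (suc k)) + sumTo n (λ k → ι (n C k) * f (suc k)))
      ≈⟨ +-assoc _ _ _ ⟨
    ι (n C 0) * f 0 + sumTo n (λ k → ι (n C suc k) * f (suc k)) + sumTo n (λ k → ι (n C k) * f (suc k))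
      ≈⟨ +-congʳ (sumTo-suc n _) ⟨
    sumTo (suc n) (λ k → ι (n C k) * f k) + sumTo n (λ k → ι (n C k) * f (suc k))
      ≈⟨ +-congʳ (+-congˡ vanishing) ⟩
    sumTo n (λ k → ι (n C k) * f k) + 0# + sumTo n (λ k → ι (n C k) * f (suc k))
      ≈⟨ +-congʳ (+-identityʳ _) ⟩
    sumTo n (λ k → ι (n C k) * f k) + sumTo n (λ k → ι (n C k) * f (suc k))
      ∎
    where
    pascal : ∀ k → ι (suc n C suc k) * f (suc k) ≈ ι (n C suc k) * f (suc k) + ι (n C k) * f (suc k)
    pascal k = begin
      ι (suc n C suc k) * f (suc k)                  ≈⟨ *-congʳ (≡⇒≈ ι (nCk+nC[k+1]≡[n+1]C[k+1] n k)) ⟨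
      ι (n C k ℕ.+ n C suc k) * f (suc k)            ≈⟨ *-congʳ (trans (ι-+ (n C k) (n C suc k)) (+-comm _ _)) ⟩
      (ι (n C suc k) + ι (n C k)) * f (suc k)        ≈⟨ distribʳ _ _ _ ⟩
      ι (n C suc k) * f (suc k) + ι (n C k) * f (suc k) ∎
    vanishing : ι (n C suc n) * f (suc n) ≈ 0#
    vanishing = trans (*-congʳ (≡⇒≈ ι (k>n⇒nCk≡0 (ℕ.n<1+n n)))) (zeroˡ _)

  binomialSum : ℕ → Carrier → Carrier → (ℕ → ℕ → Carrier) → Carrier
  binomialSum n x y f = sumTo n (λ k → ι (n C k) * (pow x (n ∸ k) * pow y k * f (n ∸ k) k))

  binomialSum-cong : ∀ n x y {f g} → (∀ i j → f i j ≈ g i j) → binomialSum n x y f ≈ binomialSum n x y g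
  binomialSum-cong n x y f≈g = sumTo-cong n (λ k _ → *-congˡ (*-congˡ (f≈g (n ∸ k) k)))

  binomialSum-+ : ∀ n x y f g →
    binomialSum n x y (λ i j → f i j + g i j) ≈ binomialSum n x y f + binomialSum n x y g
  binomialSum-+ n x y f g =
    trans (sumTo-cong n (λ k _ → distrib (ι (n C k)) (pow x (n ∸ k) * pow y k) (f (n ∸ k) k) (g (n ∸ k) k)))
          (sumTo-+ n _ _)
    where
    distrib : ∀ c a φ ψ → c * (a * (φ + ψ)) ≈ c * (a * φ) + c * (a * ψ)
    distrib = solve 4 (λ c a φ ψ → c :* (a :* (φ :+ ψ)) := c :* (a :* φ) :+ c :* (a :* ψ)) refl

  binomialSum-*ˡ : ∀ n x y α f → α * binomialSum n x y f ≈ binomialSum n x y (λ i j → α * f i j)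
  binomialSum-*ˡ n x y α f =
    trans (sumTo-*ˡ n α _)
          (sumTo-cong n (λ k _ → commute α (ι (n C k)) (pow x (n ∸ k) * pow y k) (f (n ∸ k) k)))
    where
    commute : ∀ α c a φ → α * (c * (a * φ)) ≈ c * (a * (α * φ))
    commute = solve 4 (λ α c a φ → α :* (c :* (a :* φ)) := c :* (a :* (α :* φ))) refl

  binomialSum-suc : ∀ n x y f →
    binomialSum (suc n) x y f
      ≈ x * binomialSum n x y (λ i j → f (suc i) j) + y * binomialSum n x y (λ i j → f i (suc j))
  binomialSum-suc n x y f = begin
    binomialSum (suc n) x y f
      ≈⟨ sumTo-pascal n _ ⟩
    sumTo n (λ k → ι (n C k) * (pow x (suc n ∸ k) * pow y k * f (suc n ∸ k) k))
      + sumTo n (λ k → ι (n C k) * (pow x (n ∸ k) * (y * pow y k) * f (n ∸ k) (suc k)))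
      ≈⟨ +-cong (sumTo-cong n pull-x) (sumTo-cong n (λ k _ → pull (ι (n C k)) (pow x (n ∸ k)) y (pow y k) _)) ⟩
    sumTo n (λ k → x * (ι (n C k) * (pow x (n ∸ k) * pow y k * f (suc (n ∸ k)) k)))
      + sumTo n (λ k → y * (ι (n C k) * (pow x (n ∸ k) * pow y k * f (n ∸ k) (suc k))))
      ≈⟨ +-cong (sumTo-*ˡ n x _) (sumTo-*ˡ n y _) ⟨
    x * binomialSum n x y (λ i j → f (suc i) j) + y * binomialSum n x y (λ i j → f i (suc j))
      ∎
    where
    pull : ∀ c a z b φ → c * (a * (z * b) * φ) ≈ z * (c * (a * b * φ))
    pull = solve 5 (λ c a z b φ → c :* (a :* (z :* b) :* φ) := z :* (c :* (a :* b :* φ))) refl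
    pull-x : ∀ k → k ≤ n → ι (n C k) * (pow x (suc n ∸ k) * pow y k * f (suc n ∸ k) k)
                           ≈ x * (ι (n C k) * (pow x (n ∸ k) * pow y k * f (suc (n ∸ k)) k))
    pull-x k k≤n rewrite ℕ.+-∸-assoc 1 k≤n =
      solve 5 (λ c x a b φ → c :* (x :* a :* b :* φ) := x :* (c :* (a :* b :* φ))) refl _ x _ _ _

  Pascal : (ℕ → ℕ → Carrier) → Set ℓ
  Pascal b = ∀ i j → b (suc i) (suc j) ≈ b i (suc j) + b i j

  Balanced : Carrier → Carrier → Carrier → (ℕ → ℕ → Carrier) → Set ℓ
  Balanced u v w g = ∀ i j → u * g (suc i) j + v * g i (suc j) ≈ w * g i j

  binomialSum-edge-suc : ∀ n {u v w b g} → Pascal b → Balanced u v w g →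
    binomialSum (suc n) w v (λ _ j → b 0 j * g 0 j)
      ≈ u * binomialSum n w v (λ _ j → b 0 j * g 1 j) + v * binomialSum n w v (λ _ j → b 1 (suc j) * g 0 (suc j))
  binomialSum-edge-suc n {u} {v} {w} {b} {g} pascal balanced = begin
    binomialSum (suc n) w v e₀
      ≈⟨ binomialSum-suc n w v e₀ ⟩
    w * binomialSum n w v e₀ + v * binomialSum n w v e₃
      ≈⟨ +-congʳ (binomialSum-*ˡ n w v w e₀) ⟩
    binomialSum n w v (λ i j → w * e₀ i j) + v * binomialSum n w v e₃
      ≈⟨ +-congʳ (binomialSum-cong n w v (λ _ → split)) ⟩
    binomialSum n w v (λ i j → u * e₁ i j + v * e₂ i j) + v * binomialSum n w v e₃
      ≈⟨ +-congʳ (binomialSum-+ n w v (λ i j → u * e₁ i j) (λ i j → v * e₂ i j)) ⟩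
    binomialSum n w v (λ i j → u * e₁ i j) + binomialSum n w v (λ i j → v * e₂ i j) + v * binomialSum n w v e₃
      ≈⟨ +-congʳ (+-cong (binomialSum-*ˡ n w v u e₁) (binomialSum-*ˡ n w v v e₂)) ⟨
    u * binomialSum n w v e₁ + v * binomialSum n w v e₂ + v * binomialSum n w v e₃
      ≈⟨ solve 4 (λ a v y x → a :+ v :* y :+ v :* x := a :+ v :* (x :+ y)) refl _ v _ _ ⟩
    u * binomialSum n w v e₁ + v * (binomialSum n w v e₃ + binomialSum n w v e₂)
      ≈⟨ +-congˡ (*-congˡ (binomialSum-+ n w v e₃ e₂)) ⟨
    u * binomialSum n w v e₁ + v * binomialSum n w v (λ i j → e₃ i j + e₂ i j)
      ≈⟨ +-congˡ (*-congˡ (binomialSum-cong n w v (λ _ j → sym (trans (*-congʳ (pascal 0 j)) (distribʳ (g 0 (suc j)) _ _))))) ⟩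
    u * binomialSum n w v e₁ + v * binomialSum n w v (λ _ j → b 1 (suc j) * g 0 (suc j))
      ∎
    where
    e₀ e₁ e₂ e₃ : ℕ → ℕ → Carrier
    e₀ _ j = b 0 j * g 0 j
    e₁ _ j = b 0 j * g 1 j
    e₂ _ j = b 0 j * g 0 (suc j)
    e₃ _ j = b 0 (suc j) * g 0 (suc j)
    split : ∀ j → w * e₀ 0 j ≈ u * e₁ 0 j + v * e₂ 0 j
    split j = begin
      w * (b 0 j * g 0 j)
        ≈⟨ solve 3 (λ w β γ → w :* (β :* γ) := β :* (w :* γ)) refl w (b 0 j) (g 0 j) ⟩
      b 0 j * (w * g 0 j)
        ≈⟨ *-congˡ (balanced 0 j) ⟨
      b 0 j * (u * g 1 j + v * g 0 (suc j))
        ≈⟨ solve 5 (λ β u γ v δ → β :* (u :* γ :+ v :* δ) := u :* (β :* γ) :+ v :* (β :* δ)) refl (b 0 j) u (g 1 j) v (g 0 (suc j)) ⟩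
      u * (b 0 j * g 1 j) + v * (b 0 j * g 0 (suc j))
        ∎

  -- As functions F n b g, both sides satisfy  F (1 + n) b g ≈ u * F n b g↑ + v * F n b↗ g→
  -- with g↑ i j = g (1 + i) j, g→ i j = g i (1 + j) and b↗ i j = b (1 + i) (1 + j).
  binomialSum-transfer : ∀ n {u v w b g} → Pascal b → Balanced u v w g →
    binomialSum n u v (λ i j → b j j * g i j) ≈ binomialSum n w v (λ _ j → b 0 j * g 0 j)
  binomialSum-transfer zero    _ _ = refl
  binomialSum-transfer (suc n) {u} {v} {w} {b} {g} pascal balanced = begin
    binomialSum (suc n) u v (λ i j → b j j * g i j)
      ≈⟨ binomialSum-suc n u v (λ i j → b j j * g i j) ⟩
    u * binomialSum n u v (λ i j → b j j * g (suc i) j)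
      + v * binomialSum n u v (λ i j → b (suc j) (suc j) * g i (suc j))
      ≈⟨ +-cong (*-congˡ (binomialSum-transfer n pascal (λ i → balanced (suc i))))
                (*-congˡ (binomialSum-transfer n (λ i j → pascal (suc i) (suc j)) (λ i j → balanced i (suc j)))) ⟩
    u * binomialSum n w v (λ _ j → b 0 j * g 1 j)
      + v * binomialSum n w v (λ _ j → b 1 (suc j) * g 0 (suc j))
      ≈⟨ binomialSum-edge-suc n pascal balanced ⟨
    binomialSum (suc n) w v (λ _ j → b 0 j * g 0 j)
      ∎

  binom-Pascal : ∀ m → Pascal (λ i j → binom (m + ι i) j)
  binom-Pascal m i j = begin
    binom (m + (1# + ι i)) (suc j)
      ≈⟨ binom-cong (suc j) (solve 2 (λ m x → m :+ (con 1 :+ x) := m :+ x :+ con 1) refl m (ι i)) ⟩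
    binom (m + ι i + 1#) (suc j)
      ≈⟨ binom-pascal (m + ι i) j ⟩
    binom (m + ι i) (suc j) + binom (m + ι i) j
      ∎

  Recurrent : Carrier → Carrier → (ℤ → Carrier) → Set ℓ
  Recurrent p q g = ∀ j → g (ℤ.suc (ℤ.suc j)) + q * g j ≈ p * g (ℤ.suc j)

  module _ {p q : Carrier} where

    recurrent-+ : ∀ {g h} → Recurrent p q g → Recurrent p q h → Recurrent p q (λ j → g j + h j)
    recurrent-+ {g} {h} rec-g rec-h j = begin
      g (ℤ.suc (ℤ.suc j)) + h (ℤ.suc (ℤ.suc j)) + q * (g j + h j)
        ≈⟨ solve 5 (λ a b q c d → a :+ b :+ q :* (c :+ d) := a :+ q :* c :+ (b :+ q :* d)) refl _ _ q _ _ ⟩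
      g (ℤ.suc (ℤ.suc j)) + q * g j + (h (ℤ.suc (ℤ.suc j)) + q * h j)
        ≈⟨ +-cong (rec-g j) (rec-h j) ⟩
      p * g (ℤ.suc j) + p * h (ℤ.suc j)
        ≈⟨ distribˡ p _ _ ⟨
      p * (g (ℤ.suc j) + h (ℤ.suc j))
        ∎

    recurrent-*ˡ : ∀ {g} x → Recurrent p q g → Recurrent p q (λ j → x * g j)
    recurrent-*ˡ {g} x rec-g j = begin
      x * g (ℤ.suc (ℤ.suc j)) + q * (x * g j)
        ≈⟨ solve 4 (λ x a q b → x :* a :+ q :* (x :* b) := x :* (a :+ q :* b)) refl x _ q _ ⟩
      x * (g (ℤ.suc (ℤ.suc j)) + q * g j)
        ≈⟨ *-congˡ (rec-g j) ⟩
      x * (p * g (ℤ.suc j))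
        ≈⟨ solve 3 (λ x p a → x :* (p :* a) := p :* (x :* a)) refl x p _ ⟩
      p * (x * g (ℤ.suc j))
        ∎

    recurrent-*ʳ : ∀ {g} x → Recurrent p q g → Recurrent p q (λ j → g j * x)
    recurrent-*ʳ {g} x rec-g j = begin
      g (ℤ.suc (ℤ.suc j)) * x + q * (g j * x)  ≈⟨ +-cong (*-comm _ x) (*-congˡ (*-comm _ x)) ⟩
      x * g (ℤ.suc (ℤ.suc j)) + q * (x * g j)  ≈⟨ recurrent-*ˡ x rec-g j ⟩
      p * (x * g (ℤ.suc j))                    ≈⟨ *-congˡ (*-comm x _) ⟩
      p * (g (ℤ.suc j) * x)                    ∎

    recurrent-shift : ∀ {g} d → Recurrent p q g → Recurrent p q (λ j → g (d ℤ.+ j))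
    recurrent-shift {g} d rec-g j = begin
      g (d ℤ.+ ℤ.suc (ℤ.suc j)) + q * g (d ℤ.+ j)
        ≈⟨ +-congʳ (≡⇒≈ g (≡.trans (+-suc d _) (≡.cong ℤ.suc (+-suc d j)))) ⟩
      g (ℤ.suc (ℤ.suc (d ℤ.+ j))) + q * g (d ℤ.+ j)
        ≈⟨ rec-g (d ℤ.+ j) ⟩
      p * g (ℤ.suc (d ℤ.+ j))
        ≈⟨ *-congˡ (≡⇒≈ g (+-suc d j)) ⟨
      p * g (d ℤ.+ ℤ.suc j)
        ∎

    module _ (q≉0 : ¬ q ≈ 0#) where

      backward-step : ∀ x y → y + q * (q ⁻¹ * (p * x - y)) ≈ p * x
      backward-step x y = trans (+-congˡ (x*[x⁻¹*y]≈y q≉0 _)) (trans (+-comm _ _) (x-y+y≈x (p * x) y))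

      -- For negative indices `Wneg` has to unfold twice, hence the three negative cases.
      W-recurrent : ∀ a b → Recurrent p q (W a b p q)
      W-recurrent a b (+ n)              = x-y+y≈x _ _
      W-recurrent a b -[1+ 0 ]           = backward-step _ _
      W-recurrent a b -[1+ 1 ]           = backward-step _ _
      W-recurrent a b -[1+ suc (suc n) ] = backward-step _ _

      recurrent-unique : ∀ {g h} → Recurrent p q g → Recurrent p q h →
        g (+ 0) ≈ h (+ 0) → g (+ 1) ≈ h (+ 1) → ∀ j → g j ≈ h j
      recurrent-unique {g} {h} rec-g rec-h g0≈h0 g1≈h1 j =
        proj₁ (ℤ-induction Agree (g0≈h0 , g1≈h1) forward backward j)
        where
        Agree : ℤ → Set ℓ
        Agree i = g i ≈ h i × g (ℤ.suc i) ≈ h (ℤ.suc i)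
        bridge : ∀ i → g (ℤ.suc i) ≈ h (ℤ.suc i) →
                 g (ℤ.suc (ℤ.suc i)) + q * g i ≈ h (ℤ.suc (ℤ.suc i)) + q * h i
        bridge i e = trans (rec-g i) (trans (*-congˡ e) (sym (rec-h i)))
        forward : ∀ i → Agree i → Agree (ℤ.suc i)
        forward i (e₀ , e₁) = e₁ , +-cancelʳ (q * g i) _ _ (trans (bridge i e₁) (+-congˡ (*-congˡ (sym e₀))))
        backward : ∀ i → Agree (ℤ.suc i) → Agree i
        backward i (e₁ , e₂) =
          *-cancelˡ q≉0 (+-cancelˡ (g (ℤ.suc (ℤ.suc i))) _ _ (trans (bridge i e₁) (+-congʳ (sym e₂)))) , e₁

      recurrent-reflect : ∀ {g} → Recurrent p q g → ∀ t → Recurrent p q (λ r → zpow q r * g (t ℤ.- r))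
      recurrent-reflect {g} rec-g t j = begin
        zpow q (ℤ.suc (ℤ.suc j)) * g x + q * (zpow q j * g (t ℤ.- j))
          ≈⟨ +-cong (*-congʳ (zpow-suc q≉0 (ℤ.suc j))) (trans (sym (*-assoc _ _ _)) (*-congʳ (sym (zpow-suc q≉0 j)))) ⟩
        q * zpow q (ℤ.suc j) * g x + zpow q (ℤ.suc j) * g (t ℤ.- j)
          ≈⟨ solve 4 (λ q z a b → q :* z :* a :+ z :* b := z :* (b :+ q :* a)) refl q _ (g x) _ ⟩
        zpow q (ℤ.suc j) * (g (t ℤ.- j) + q * g x)
          ≈⟨ *-congˡ (trans (+-congʳ (≡⇒≈ g x+2≡t-j)) (trans (rec-g x) (*-congˡ (≡⇒≈ g (suc[i-suc[j]] t (ℤ.suc j)))))) ⟩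
        zpow q (ℤ.suc j) * (p * g (t ℤ.- ℤ.suc j))
          ≈⟨ solve 3 (λ z p a → z :* (p :* a) := p :* (z :* a)) refl _ p _ ⟩
        p * (zpow q (ℤ.suc j) * g (t ℤ.- ℤ.suc j))
          ∎
        where
        x : ℤ
        x = t ℤ.- ℤ.suc (ℤ.suc j)
        x+2≡t-j : t ℤ.- j ≡ ℤ.suc (ℤ.suc x)
        x+2≡t-j = ≡.sym (≡.trans (≡.cong ℤ.suc (suc[i-suc[j]] t (ℤ.suc j))) (suc[i-suc[j]] t j))

      module _ (a b : Carrier) where

        W-addition-one : ∀ t r → U p q r * W a b p q (ℤ.suc t) + zpow q r * W a b p q (t ℤ.- r)
                                   ≈ U p q (ℤ.suc r) * W a b p q t
        W-addition-one t = recurrent-unique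
          (recurrent-+ (recurrent-*ʳ _ (W-recurrent 0# 1#)) (recurrent-reflect (W-recurrent a b) t))
          (recurrent-*ʳ _ (recurrent-shift (+ 1) (W-recurrent 0# 1#)))
          at-0 at-1
          where
          at-0 : 0# * W a b p q (ℤ.suc t) + 1# * W a b p q (t ℤ.+ + 0) ≈ 1# * W a b p q t
          at-0 = trans (+-cong (zeroˡ _) (*-congˡ (≡⇒≈ (W a b p q) (ℤ.+-identityʳ t)))) (+-identityˡ _)
          at-1 : 1# * W a b p q (ℤ.suc t) + q * 1# * W a b p q (t ℤ.- + 1) ≈ (p * 1# - q * 0#) * W a b p q t
          at-1 = begin
            1# * W a b p q (ℤ.suc t) + q * 1# * W a b p q (t ℤ.- + 1)
              ≈⟨ +-cong (trans (*-identityˡ _) (≡⇒≈ (W a b p q) (≡.sym t-1+2≡t+1))) (*-congʳ (*-identityʳ q)) ⟩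
            W a b p q (ℤ.suc (ℤ.suc (t ℤ.- + 1))) + q * W a b p q (t ℤ.- + 1)
              ≈⟨ W-recurrent a b (t ℤ.- + 1) ⟩
            p * W a b p q (ℤ.suc (t ℤ.- + 1))
              ≈⟨ *-cong p≈U₂ (≡⇒≈ (W a b p q) (suc[i-suc[j]] t (+ 0))) ⟩
            (p * 1# - q * 0#) * W a b p q (t ℤ.- + 0)
              ≈⟨ *-congˡ (≡⇒≈ (W a b p q) (ℤ.+-identityʳ t)) ⟩
            (p * 1# - q * 0#) * W a b p q t
              ∎
            where
            t-1+2≡t+1 : ℤ.suc (ℤ.suc (t ℤ.- + 1)) ≡ ℤ.suc t
            t-1+2≡t+1 = ≡.cong ℤ.suc (≡.trans (suc[i-suc[j]] t (+ 0)) (ℤ.+-identityʳ t))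
            p≈U₂ : p ≈ p * 1# - q * 0#
            p≈U₂ = sym (trans (+-cong (*-identityʳ p) (trans (-‿cong (zeroʳ q)) -0#≈0#)) (+-identityʳ p))

        W-addition : ∀ r s t → U p q r * W a b p q (t ℤ.+ s) + zpow q r * U p q s * W a b p q (t ℤ.- r)
                                 ≈ U p q (r ℤ.+ s) * W a b p q t
        W-addition r s t = recurrent-unique
          {λ s → U p q r * W a b p q (t ℤ.+ s) + zpow q r * U p q s * W a b p q (t ℤ.- r)}
          (recurrent-+ (recurrent-*ˡ _ (recurrent-shift t (W-recurrent a b)))
                       (recurrent-*ʳ _ (recurrent-*ˡ _ (W-recurrent 0# 1#))))
          (recurrent-*ʳ _ (recurrent-shift r (W-recurrent 0# 1#)))
          at-0 at-1 s
          where
          at-0 : U p q r * W a b p q (t ℤ.+ + 0) + zpow q r * 0# * W a b p q (t ℤ.- r)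
                 ≈ U p q (r ℤ.+ + 0) * W a b p q t
          at-0 = begin
            U p q r * W a b p q (t ℤ.+ + 0) + zpow q r * 0# * W a b p q (t ℤ.- r)
              ≈⟨ +-cong (*-congˡ (≡⇒≈ (W a b p q) (ℤ.+-identityʳ t))) (trans (*-congʳ (zeroʳ _)) (zeroˡ _)) ⟩
            U p q r * W a b p q t + 0#
              ≈⟨ +-identityʳ _ ⟩
            U p q r * W a b p q t
              ≈⟨ *-congʳ (≡⇒≈ (U p q) (ℤ.+-identityʳ r)) ⟨
            U p q (r ℤ.+ + 0) * W a b p q t
              ∎
          at-1 : U p q r * W a b p q (t ℤ.+ + 1) + zpow q r * 1# * W a b p q (t ℤ.- r)
                 ≈ U p q (r ℤ.+ + 1) * W a b p q t
          at-1 = begin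
            U p q r * W a b p q (t ℤ.+ + 1) + zpow q r * 1# * W a b p q (t ℤ.- r)
              ≈⟨ +-cong (*-congˡ (≡⇒≈ (W a b p q) (ℤ.+-comm t (+ 1)))) (*-congʳ (*-identityʳ _)) ⟩
            U p q r * W a b p q (ℤ.suc t) + zpow q r * W a b p q (t ℤ.- r)
              ≈⟨ W-addition-one t r ⟩
            U p q (ℤ.suc r) * W a b p q t
              ≈⟨ *-congʳ (≡⇒≈ (U p q) (ℤ.+-comm r (+ 1))) ⟨
            U p q (r ℤ.+ + 1) * W a b p q t
              ∎

        W-Balanced : ∀ r s t → Balanced (U p q r) (zpow q r * U p q s) (U p q (r ℤ.+ s))
                                        (λ i j → W a b p q (t ℤ.+ s ℤ.* + i ℤ.- r ℤ.* + j))
        W-Balanced r s t i j = begin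
          U p q r * W a b p q (t ℤ.+ s ℤ.* + suc i ℤ.- r ℤ.* + j)
            + zpow q r * U p q s * W a b p q (t ℤ.+ s ℤ.* + i ℤ.- r ℤ.* + suc j)
            ≈⟨ +-cong (*-congˡ (≡⇒≈ (W a b p q) (t+s[1+i]-rj≡[t+si-rj]+s t r s (+ i) (+ j))))
                      (*-congˡ (≡⇒≈ (W a b p q) (t+si-r[1+j]≡[t+si-rj]-r t r s (+ i) (+ j)))) ⟩
          U p q r * W a b p q (T ℤ.+ s) + zpow q r * U p q s * W a b p q (T ℤ.- r)
            ≈⟨ W-addition r s T ⟩
          U p q (r ℤ.+ s) * W a b p q T
            ∎
          where
          T : ℤ
          T = t ℤ.+ s ℤ.* + i ℤ.- r ℤ.* + j

  reassociate : ∀ {c β β′ z x y v ω ω′} → β ≈ β′ → z * y ≈ v → ω ≈ ω′ →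
    c * β * z * x * y * ω ≈ c * (x * v * (β′ * ω′))
  reassociate {c} {β} {β′} {z} {x} {y} {v} {ω} {ω′} β≈β′ zy≈v ω≈ω′ = begin
    c * β * z * x * y * ω
      ≈⟨ solve 6 (λ c β z x y ω → c :* β :* z :* x :* y :* ω := c :* (x :* (z :* y) :* (β :* ω))) refl c β z x y ω ⟩
    c * (x * (z * y) * (β * ω))
      ≈⟨ *-congˡ (*-cong (*-congˡ zy≈v) (*-cong β≈β′ ω≈ω′)) ⟩
    c * (x * v * (β′ * ω′))
      ∎

theorem53 : ∀ {c ℓ} (F : CharZeroField c ℓ) → let open CharZeroField F in
    (a b p q m : Carrier) → ¬ (p ≈ 0#) → ¬ (q ≈ 0#) →
    (n : ℕ) (r s t : ℤ) →
    sumTo n (λ k → ι (n C k) * binom (m + ι k) k * zpow q (r ℤ.* + k) * pow (U p q r) (n ∸ k) * pow (U p q s) k * W a b p q ((t ℤ.- (r ℤ.+ s) ℤ.* + k) ℤ.+ s ℤ.* + n))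
    ≈ sumTo n (λ k → ι (n C k) * binom m k * zpow q (r ℤ.* + k) * pow (U p q (r ℤ.+ s)) (n ∸ k) * pow (U p q s) k * W a b p q (t ℤ.- r ℤ.* + k))
theorem53 F a b p q m _ q≉0 n r s t = begin
  _ ≈⟨ sumTo-cong n (λ k k≤n → reassociate refl (q^[rk]U^k≈v^k k) (≡⇒≈ (W a b p q) (lhs-index k≤n))) ⟩
  binomialSum n (U p q r) v (λ i j → binom (m + ι j) j * g i j)
    ≈⟨ binomialSum-transfer n (binom-Pascal m) (W-Balanced q≉0 a b r s t) ⟩
  binomialSum n (U p q (r ℤ.+ s)) v (λ _ j → binom (m + ι 0) j * g 0 j)
    ≈⟨ sumTo-cong n (λ k _ → reassociate (binom-cong k (sym (+-identityʳ m))) (q^[rk]U^k≈v^k k)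
                                         (≡⇒≈ (W a b p q) (t-rj≡t+s0-rj t r s (+ k)))) ⟨
  _ ∎
  where
  open CharZeroField F
  open Lemmas F
  open CommutativeRing commutativeRing using (refl; sym; trans; *-congʳ; +-identityʳ)
  open import Relation.Binary.Reasoning.Setoid (CommutativeRing.setoid commutativeRing)
  v : Carrier
  v = zpow q r * U p q s
  g : ℕ → ℕ → Carrier
  g i j = W a b p q (t ℤ.+ s ℤ.* + i ℤ.- r ℤ.* + j)
  q^[rk]U^k≈v^k : ∀ k → zpow q (r ℤ.* + k) * pow (U p q s) k ≈ pow v k
  q^[rk]U^k≈v^k k = trans (*-congʳ (zpow-*-pow q≉0 r k)) (sym (pow-* (zpow q r) (U p q s) k))
  lhs-index : ∀ {k} → k ≤ n → (t ℤ.- (r ℤ.+ s) ℤ.* + k) ℤ.+ s ℤ.* + n ≡ t ℤ.+ s ℤ.* + (n ∸ k) ℤ.- r ℤ.* + k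
  lhs-index {k} k≤n = ≡.trans (≡.cong (λ i → (t ℤ.- (r ℤ.+ s) ℤ.* + k) ℤ.+ s ℤ.* + i) (≡.sym (ℕ.m∸n+n≡m k≤n)))
                              ([t-[r+s]j]+s[i+j]≡t+si-rj t r s (+ (n ∸ k)) (+ k))
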